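{- Let $\mu=(B_1|\dots|B_k)$ be an ordered multiset partition, fix a letter $i$, and let $w(\mu)=w[1]\cdots w[k]$ be the segmented word defined in the context. For each $1\le\ell\le k$, exactly one of the following holds for the segment $w[\ell]$: (1) $w[\ell]$ contains at most one letter from $\{i,i+1\}$; (2) both $i$ and $i+1$ appear in $w[\ell]$, are adjacent, and occur in the order $i(i+1)$; (3) both $i$ and $i+1$ appear in $w[\ell]$, $i+1$ is the first letter of $w[\ell]$, $i$ is the last letter of $w[\ell]$, and moreover $\ell<k$ and the first letter of $w[\ell+1]$ is $i$.
   Context: An ordered multiset partition is a sequence $(B_1|\dots|B_k)$ of nonempty finite sets of positive integers (no repeated letters within a block). Segments: write $B_s=\{j^{(s)}_1<\cdots<j^{(s)}_{\alpha_s}\}$; $w[k]=j^{(k)}_1\cdots j^{(k)}_{\alpha_k}$; for $s=k-1,\dots,1$, with $r$ the first letter of $w[s+1]$ and $0\le m\le\alpha_s$ maximal such that $j^{(s)}_m\le r$ ($j^{(s)}_0=-\infty$), set $w[s]=j^{(s)}_{m+1}\cdots j^{(s)}_{\alpha_s}j^{(s)}_1\cdots j^{(s)}_m$. -}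

module Defs where

open import Data.Nat using (ℕ; zero; suc; _≤_; _<_; _≤?_)
open import Data.Nat.Properties using ()
open import Data.List using (List; []; _∷_; _++_; length; head; last; lookup; takeWhile; dropWhile)
open import Data.List.Relation.Unary.All using (All)
open import Data.List.Relation.Unary.Linked using (Linked)
open import Data.List.Membership.Propositional using (_∈_)
open import Data.Maybe using (Maybe; just; nothing)
open import Data.Fin using (Fin; toℕ; fromℕ<)
open import Data.Product using (Σ; ∃; ∃-syntax; _×_; _,_)
open import Data.Sum using (_⊎_)
open import Relation.Nullary using (¬_)
open import Relation.Binary.PropositionalEquality using (_≡_; _≢_)

IsBlock : List ℕ → Set
IsBlock B = (B ≢ []) × Linked _<_ B × All (λ j → 1 ≤ j) B

IsOMP : List (List ℕ) → Set
IsOMP μ = All IsBlock μ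

-- Given block B (increasing) and r, with m maximal such that j_m ≤ r,
-- produce j_{m+1} ... j_α j_1 ... j_m.
rotateAt : ℕ → List ℕ → List ℕ
rotateAt r B = dropWhile (λ x → x ≤? r) B ++ takeWhile (λ x → x ≤? r) B

-- Segments w[1], ..., w[k], computed from the last block backwards.
-- (The 'nothing' case never occurs for blocks that are nonempty.)
segments : List (List ℕ) → List (List ℕ)
segments [] = []
segments (B ∷ []) = B ∷ []
segments (B ∷ C ∷ μ) with segments (C ∷ μ)
... | [] = B ∷ []
... | w ∷ ws with head w
...   | nothing = B ∷ w ∷ ws
...   | just r  = rotateAt r B ∷ w ∷ ws

Case1 : ℕ → List ℕ → Set
Case1 i w = ¬ (i ∈ w × suc i ∈ w)

Case2 : ℕ → List ℕ → Set
Case2 i w = i ∈ w × suc i ∈ w × ∃[ xs ] ∃[ ys ] (w ≡ xs ++ i ∷ suc i ∷ ys)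

-- Case (3) for segment number ℓ (0-based) of the segment list ws.
Case3 : ℕ → (ws : List (List ℕ)) → Fin (length ws) → Set
Case3 i ws ℓ =
  let w = lookup ws ℓ in
  i ∈ w × suc i ∈ w × head w ≡ just (suc i) × last w ≡ just i ×
  Σ (suc (toℕ ℓ) < length ws) (λ p → head (lookup ws (fromℕ< p)) ≡ just i)

ExactlyOne : Set → Set → Set → Set
ExactlyOne P Q R = (P ⊎ Q ⊎ R) × ¬ (P × Q) × ¬ (P × R) × ¬ (Q × R)

-- Every segment is a block B or a rotation of B at r, the first letter of the next
-- segment; either way it is a duplicate-free rearrangement of B. If i and i+1 both
-- occur, they are adjacent in the increasing list B, and rotating B keeps them
-- adjacent unless the cut falls exactly between them, that is unless i ≤ r < i+1.
-- Then r = i, and the rotated segment starts with i+1, ends with i, and is followed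
-- by a segment starting with i. Cases (2) and (3) exclude each other because a
-- duplicate-free word starting with i+1 cannot contain i(i+1) as a factor.
module Submission where

open import Defs
open import Data.Nat using (ℕ; suc; _≤_; _<_; _≤?_; _≟_; s≤s; s≤s⁻¹; z≤n)
open import Data.Nat.Properties using (<-trans; <-asym; n<1+n; <⇒≢; ≤⇒≯; ≰⇒>; ≤-antisym)
open import Data.List using (List; []; _∷_; _++_; _∷ʳ_; length; lookup; head; last; takeWhile; dropWhile)
open import Data.List.Properties using (++-assoc; ∷-injective; takeWhile++dropWhile)
open import Data.List.Relation.Unary.All as All using (All; _∷_)
open import Data.List.Relation.Unary.All.Properties using (all-takeWhile; all-head-dropWhile)
open import Data.List.Relation.Unary.AllPairs as AllPairs using (AllPairs; _∷_)
open import Data.List.Relation.Unary.Linked.Properties using (Linked⇒AllPairs)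
open import Data.List.Relation.Unary.Unique.Propositional using (Unique)
open import Data.List.Relation.Unary.Any using (here; there)
open import Data.List.Membership.Propositional using (_∈_)
open import Data.List.Membership.Propositional.Properties using (∈-++⁺ʳ)
open import Data.List.Membership.DecPropositional _≟_ using (_∈?_)
open import Data.List.Relation.Binary.Permutation.Propositional using (_↭_; ↭-trans; ↭-reflexive; ↭-sym; ↭⇒↭ₛ)
open import Data.List.Relation.Binary.Permutation.Propositional.Properties using (++-comm; ∈-resp-↭)
open import Data.List.Relation.Binary.Permutation.Setoid.Properties using (Unique-resp-↭)
open import Data.Maybe using (just; nothing)
open import Data.Maybe.Relation.Unary.All as Maybe using (drop-just)
open import Data.Fin using (Fin; zero; suc; toℕ; fromℕ<)
open import Data.Product using (∃₂; _×_; _,_; proj₁; proj₂)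
open import Data.Sum using (_⊎_; inj₁; inj₂)
open import Data.Empty using (⊥-elim)
open import Function using (_∘_)
open import Relation.Nullary using (¬_; yes; no)
open import Relation.Binary.PropositionalEquality using (_≡_; _≢_; refl; sym; trans; cong; subst; setoid)

private
  variable
    A : Set
    x y : A
    p q w : List A

Adjacent : A → A → List A → Set
Adjacent x y w = ∃₂ λ xs ys → w ≡ xs ++ x ∷ y ∷ ys

adjacent-++⁺ˡ : ∀ p → Adjacent x y q → Adjacent x y (q ++ p)
adjacent-++⁺ˡ p (xs , ys , refl) = xs , ys ++ p , ++-assoc xs _ p

adjacent-++⁺ʳ : ∀ q → Adjacent x y p → Adjacent x y (q ++ p)
adjacent-++⁺ʳ q (xs , ys , refl) = q ++ xs , ys , sym (++-assoc q xs _)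

adjacent-++⁻ : ∀ p q → Adjacent x y (p ++ q) →
  Adjacent x y p ⊎ Adjacent x y q ⊎ (∃₂ λ as bs → p ≡ as ∷ʳ x × q ≡ y ∷ bs)
adjacent-++⁻ [] q adj = inj₂ (inj₁ adj)
adjacent-++⁻ (_ ∷ []) q ([] , ys , refl) = inj₂ (inj₂ ([] , ys , refl , refl))
adjacent-++⁻ (_ ∷ _ ∷ p) q ([] , _ , refl) = inj₁ ([] , p , refl)
adjacent-++⁻ (a ∷ p) q (_ ∷ xs , ys , eq) with ∷-injective eq
... | refl , eq′ with adjacent-++⁻ p q (xs , ys , eq′)
...   | inj₁ (as , bs , refl) = inj₁ (a ∷ as , bs , refl)
...   | inj₂ (inj₁ adj) = inj₂ (inj₁ adj)
...   | inj₂ (inj₂ (as , bs , refl , q≡)) = inj₂ (inj₂ (a ∷ as , bs , refl , q≡))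

last-∷ʳ : ∀ (xs : List A) x → last (xs ∷ʳ x) ≡ just x
last-∷ʳ []           x = refl
last-∷ʳ (_ ∷ [])     x = refl
last-∷ʳ (_ ∷ y ∷ xs) x = last-∷ʳ (y ∷ xs) x

unique-adjacent-head : Unique w → Adjacent x y w → head w ≢ just y
unique-adjacent-head (x≢y ∷ _) ([] , _ , refl) refl = All.head x≢y refl
unique-adjacent-head (z≢ ∷ _) (_ ∷ xs , _ , refl) refl =
  All.lookup z≢ (∈-++⁺ʳ xs (there (here refl))) refl

strictlySorted⇒unique : ∀ {B} → AllPairs _<_ B → Unique B
strictlySorted⇒unique = AllPairs.map <⇒≢

strictlySorted-adjacent : ∀ {B i} → AllPairs _<_ B → i ∈ B → suc i ∈ B → Adjacent i (suc i) B
strictlySorted-adjacent (_ ∷ _) (here refl) (here ())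
strictlySorted-adjacent {_ ∷ _ ∷ B} (_ ∷ _) (here refl) (there (here refl)) = [] , B , refl
strictlySorted-adjacent (i< ∷ (y< ∷ _)) (here refl) (there (there si∈)) =
  ⊥-elim (≤⇒≯ (s≤s⁻¹ (All.lookup y< si∈)) (All.head i<))
strictlySorted-adjacent {i = i} (x< ∷ _) (there i∈) (here refl) = ⊥-elim (<-asym (All.lookup x< i∈) (n<1+n i))
strictlySorted-adjacent {x ∷ _} (_ ∷ B<) (there i∈) (there si∈) =
  adjacent-++⁺ʳ (x ∷ []) (strictlySorted-adjacent B< i∈ si∈)

rotateAt-↭ : ∀ r B → rotateAt r B ↭ B
rotateAt-↭ r B =
  ↭-trans (++-comm (dropWhile (_≤? r) B) (takeWhile (_≤? r) B)) (↭-reflexive (takeWhile++dropWhile (_≤? r) B))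

rotateAt-adjacent : ∀ r B {x y} → Adjacent x y B →
  Adjacent x y (rotateAt r B) ⊎
  (x ≤ r × ¬ y ≤ r × head (rotateAt r B) ≡ just y × last (rotateAt r B) ≡ just x)
rotateAt-adjacent r B {x} {y} adj
  with adjacent-++⁻ (takeWhile (_≤? r) B) (dropWhile (_≤? r) B)
                    (subst (Adjacent x y) (sym (takeWhile++dropWhile (_≤? r) B)) adj)
... | inj₁ adj′ = inj₁ (adjacent-++⁺ʳ (dropWhile (_≤? r) B) adj′)
... | inj₂ (inj₁ adj′) = inj₁ (adjacent-++⁺ˡ (takeWhile (_≤? r) B) adj′)
... | inj₂ (inj₂ (as , bs , kept≡ , dropped≡)) = inj₂ (x≤r , y≰r , cong head rotated≡ , last≡)
  where
  x≤r : x ≤ r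
  x≤r = All.lookup (all-takeWhile (_≤? r) B) (subst (x ∈_) (sym kept≡) (∈-++⁺ʳ as (here refl)))
  y≰r : ¬ y ≤ r
  y≰r = drop-just (subst (Maybe.All _) (cong head dropped≡) (all-head-dropWhile (_≤? r) B))
  rotated≡ : rotateAt r B ≡ y ∷ bs ++ as ∷ʳ x
  rotated≡ = trans (cong (_++ takeWhile (_≤? r) B) dropped≡) (cong ((y ∷ bs) ++_) kept≡)
  last≡ : last (rotateAt r B) ≡ just x
  last≡ = trans (cong last (trans rotated≡ (sym (++-assoc (y ∷ bs) as _)))) (last-∷ʳ (y ∷ bs ++ as) x)

data SegmentShape (ws : List (List ℕ)) (ℓ : Fin (length ws)) : Set where
  block : ∀ {B} → AllPairs _<_ B → lookup ws ℓ ≡ B → SegmentShape ws ℓ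
  rotatedBlock : ∀ {B} r → AllPairs _<_ B → lookup ws ℓ ≡ rotateAt r B →
    (p : suc (toℕ ℓ) < length ws) → head (lookup ws (fromℕ< p)) ≡ just r → SegmentShape ws ℓ

segmentShape-suc : ∀ {w ws ℓ} → SegmentShape ws ℓ → SegmentShape (w ∷ ws) (suc ℓ)
segmentShape-suc (block B< eq) = block B< eq
segmentShape-suc (rotatedBlock r B< eq p next) = rotatedBlock r B< eq (s≤s p) next

segmentShape-∷ : ∀ {w ws} → SegmentShape (w ∷ ws) zero → (∀ ℓ → SegmentShape ws ℓ) →
  ∀ ℓ → SegmentShape (w ∷ ws) ℓ
segmentShape-∷ shape₀ _     zero    = shape₀
segmentShape-∷ _      shape (suc ℓ) = segmentShape-suc (shape ℓ)

segmentShape : ∀ μ → IsOMP μ → ∀ ℓ → SegmentShape (segments μ) ℓ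
segmentShape (B ∷ []) ((_ , B↗ , _) ∷ _) zero = block (Linked⇒AllPairs <-trans B↗) refl
segmentShape (B ∷ C ∷ μ) ((_ , B↗ , _) ∷ omp) ℓ
  with segments (C ∷ μ) | segmentShape (C ∷ μ) omp
... | [] | _ = segmentShape-∷ (block (Linked⇒AllPairs <-trans B↗) refl) (λ ()) ℓ
... | w ∷ ws | shape with head w in next
...   | nothing = segmentShape-∷ (block (Linked⇒AllPairs <-trans B↗) refl) shape ℓ
...   | just r = segmentShape-∷ (rotatedBlock r (Linked⇒AllPairs <-trans B↗) refl (s≤s (s≤s z≤n)) next) shape ℓ

segment-unique : ∀ {ws ℓ} → SegmentShape ws ℓ → Unique (lookup ws ℓ)
segment-unique (block B< eq) = subst Unique (sym eq) (strictlySorted⇒unique B<)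
segment-unique (rotatedBlock {B} r B< eq _ _) =
  subst Unique (sym eq) (Unique-resp-↭ (setoid ℕ) (↭⇒↭ₛ (↭-sym (rotateAt-↭ r B))) (strictlySorted⇒unique B<))

segment-case2⊎case3 : ∀ {ws ℓ} i → SegmentShape ws ℓ → i ∈ lookup ws ℓ → suc i ∈ lookup ws ℓ →
  Case2 i (lookup ws ℓ) ⊎ Case3 i ws ℓ
segment-case2⊎case3 i (block B< eq) i∈ si∈ =
  inj₁ (i∈ , si∈ , subst (Adjacent i (suc i)) (sym eq)
                         (strictlySorted-adjacent B< (subst (i ∈_) eq i∈) (subst (suc i ∈_) eq si∈)))
segment-case2⊎case3 {ws} {ℓ} i (rotatedBlock {B} r B< eq p next) i∈ si∈
  with rotateAt-adjacent r B (strictlySorted-adjacent B< (inBlock i∈) (inBlock si∈))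
  where
  inBlock : ∀ {a} → a ∈ lookup ws ℓ → a ∈ B
  inBlock {a} a∈ = ∈-resp-↭ (rotateAt-↭ r B) (subst (a ∈_) eq a∈)
... | inj₁ adj = inj₁ (i∈ , si∈ , subst (Adjacent i (suc i)) (sym eq) adj)
... | inj₂ (i≤r , si≰r , first , final) =
  inj₂ (i∈ , si∈ , trans (cong head eq) first , trans (cong last eq) final , p ,
        trans next (cong just (≤-antisym (s≤s⁻¹ (≰⇒> si≰r)) i≤r)))

segment-trichotomy : ∀ {ws ℓ} i → SegmentShape ws ℓ →
  ExactlyOne (Case1 i (lookup ws ℓ)) (Case2 i (lookup ws ℓ)) (Case3 i ws ℓ)
segment-trichotomy {ws} {ℓ} i shape =
  exists , (λ (c1 , i∈ , si∈ , _) → c1 (i∈ , si∈)) , (λ (c1 , i∈ , si∈ , _) → c1 (i∈ , si∈)) ,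
  λ ((_ , _ , adj) , (_ , _ , first , _)) → unique-adjacent-head (segment-unique shape) adj first
  where
  exists : Case1 i (lookup ws ℓ) ⊎ Case2 i (lookup ws ℓ) ⊎ Case3 i ws ℓ
  exists with i ∈? lookup ws ℓ | suc i ∈? lookup ws ℓ
  ... | no i∉    | _         = inj₁ (i∉ ∘ proj₁)
  ... | yes _    | no si∉    = inj₁ (si∉ ∘ proj₂)
  ... | yes i∈   | yes si∈   = inj₂ (segment-case2⊎case3 i shape i∈ si∈)

lemma3p8 : (μ : List (List ℕ)) → IsOMP μ → (i : ℕ) → 1 ≤ i →
    (ℓ : Fin (length (segments μ))) →
    ExactlyOne (Case1 i (lookup (segments μ) ℓ))
               (Case2 i (lookup (segments μ) ℓ))
               (Case3 i (segments μ) ℓ)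
lemma3p8 μ omp i _ ℓ = segment-trichotomy i (segmentShape μ omp ℓ)
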